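{- Let $G=(V,E)$ be a simple undirected graph with no isolated vertices, with a split partition $(K,I)$ (i.e. $V=K\cup I$ disjointly, $K$ a clique, $I$ an independent set) such that every vertex of $K$ has at least one neighbor in $I$. Assume $G$ is equimatchable with $|I|\geq 3$ and $|K|\geq 2$. If $v\in K$ and $i\in I$ satisfy $vi\notin E$, then for every $j\in N_I(v)$ either $N(j)=K\setminus N(i)$ or $N(j)=K$.
   Context: $N(u)$ denotes the set of neighbors of a vertex $u$, and $N_I(v)=N(v)\cap I$. A matching is a set of pairwise vertex-disjoint edges; it is maximal if it is not properly contained in another matching. A graph is equimatchable if all its maximal matchings have the same number of edges. A vertex is isolated if it has no neighbors. -}

module Defs where

open import Data.Nat using (ℕ; _≥_)
open import Data.Fin using (Fin)
open import Data.Bool using (Bool; true; false)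
open import Data.Product using (_×_; _,_; Σ; ∃-syntax)
open import Data.List using (List; length; filterᵇ; allFin)
open import Data.List.Membership.Propositional using (_∈_)
open import Data.List.Relation.Unary.AllPairs using (AllPairs)
open import Relation.Binary.PropositionalEquality using (_≡_; _≢_)
open import Relation.Nullary using (¬_)
open import Function.Bundles using (_⇔_)

record Graph (n : ℕ) : Set where
  field
    adj   : Fin n → Fin n → Bool
    sym   : ∀ u v → adj u v ≡ adj v u
    irrefl : ∀ v → adj v v ≡ false

module _ {n : ℕ} (G : Graph n) where
  open Graph G

  Adj : Fin n → Fin n → Set
  Adj u v = adj u v ≡ true

  Isolated : Fin n → Set
  Isolated v = ∀ u → ¬ Adj v u

  NoIsolated : Set
  NoIsolated = ∀ v → ¬ Isolated v

  Edge : Set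
  Edge = Fin n × Fin n

  IsEdge : Edge → Set
  IsEdge (u , v) = Adj u v

  Disjoint : Edge → Edge → Set
  Disjoint (a , b) (c , d) = a ≢ c × a ≢ d × b ≢ c × b ≢ d

  -- a matching: a list of edges of G that are pairwise vertex-disjoint
  -- (pairwise disjointness also rules out repeated edges, so length = size)
  IsMatching : List Edge → Set
  IsMatching M = (∀ {e} → e ∈ M → IsEdge e) × AllPairs Disjoint M

  -- maximal: no edge of G is vertex-disjoint from all edges of M
  -- (equivalently, M is not properly contained in another matching)
  IsMaximalMatching : List Edge → Set
  IsMaximalMatching M =
    IsMatching M ×
    (∀ e → IsEdge e → ¬ (∀ {f} → f ∈ M → Disjoint e f))

  Equimatchable : Set
  Equimatchable = ∀ M M' → IsMaximalMatching M → IsMaximalMatching M' →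
                  length M ≡ length M'

  -- split partition (K , I) encoded by the indicator inK : v ∈ K iff inK v ≡ true,
  -- v ∈ I iff inK v ≡ false (so V = K ∪ I disjointly)
  IsSplitPartition : (Fin n → Bool) → Set
  IsSplitPartition inK =
    (∀ u v → inK u ≡ true → inK v ≡ true → u ≢ v → Adj u v) ×
    (∀ u v → inK u ≡ false → inK v ≡ false → ¬ Adj u v)

count : {n : ℕ} → (Fin n → Bool) → Bool → ℕ
count {n} p b = length (filterᵇ (λ v → eqB (p v) b) (allFin n))
  where
  eqB : Bool → Bool → Bool
  eqB true true = true
  eqB false false = true
  eqB _ _ = false

module Submission where

-- The whole argument rests on one consequence of equimatchability
-- for split graphs: there are no three pairwise vertex-disjoint K–I edges.
-- Given disjoint edges ax, by, dz, pair up the remaining clique vertices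
-- (the vertex d, matched to z, absorbs a leftover one) into a matching Q
-- covering K ∖ {a, b}.  As every edge of a split graph has an endpoint in K,
-- both {ax, by} ∪ Q and {ab} ∪ Q are maximal, yet their sizes differ by one.
-- Rephrased: once K–I edges ai, bj are disjoint, every other clique vertex
-- has all its I-neighbours in {i, j} ("confinement").  If j sees all of K we
-- are in the second alternative.  Otherwise fix w ∈ K with jw ∉ E and show
-- N(j) = K ∖ N(i): a clique vertex missed by both i and j contradicts
-- confinement of the edges ci, vj (c a neighbour of i); a common neighbour u
-- of i and j forces wi ∈ E, and then a third vertex z ∈ I (|I| ≥ 3) together
-- with a neighbour c of z contradicts confinement in each case c = w, c = v,
-- c ∉ {v, w}.

open import Defs
open import Data.Nat using (ℕ; _≥_; s≤s)
open import Data.Nat.Properties using (1+n≢n)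
open import Data.Fin using (Fin)
open import Data.Fin.Properties using (any?) renaming (_≟_ to _≟F_)
open import Data.Bool using (Bool; true; false; T; T?)
open import Data.Bool.Properties using () renaming (_≟_ to _≟B_)
open import Data.Product using (_×_; ∃-syntax; Σ-syntax; _,_; proj₁; proj₂; uncurry)
open import Data.Sum using (_⊎_; inj₁; inj₂)
open import Data.Empty using (⊥; ⊥-elim)
open import Data.List using (List; []; _∷_; length; filter; filterᵇ; allFin)
open import Data.List.Membership.Propositional using (_∈_; _∉_; find)
open import Data.List.Membership.Propositional.Properties using (∈-filter⁺; ∈-filter⁻; ∈-allFin)
open import Data.List.Relation.Unary.Any using (Any; here; there)
open import Data.List.Relation.Unary.All as All using (All; []; _∷_)
open import Data.List.Relation.Unary.All.Properties using (All¬⇒¬Any)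
open import Data.List.Relation.Unary.AllPairs using (AllPairs; []; _∷_)
open import Data.List.Relation.Unary.Unique.Propositional using (Unique)
open import Data.List.Relation.Unary.Unique.Propositional.Properties using (filter⁺; allFin⁺)
open import Relation.Binary.Definitions using (DecidableEquality)
open import Relation.Binary.PropositionalEquality using (_≡_; _≢_; refl; sym; trans)
open import Relation.Nullary using (¬_; Dec; yes; no)
open import Relation.Nullary.Decidable using (_×-dec_; ¬?; decidable-stable)
open import Function using (_∘_; case_of_)
open import Function.Bundles using (_⇔_; mk⇔)

module _ {A : Set} (_≟_ : DecidableEquality A) where

  one-differs : ∀ {p q : A} → p ≢ q → ∀ t → p ≢ t ⊎ q ≢ t
  one-differs {p} p≢q t with p ≟ t
  ... | yes refl = inj₂ (p≢q ∘ sym)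
  ... | no p≢t = inj₁ p≢t

  avoid-two : ∀ xs → Unique xs → length xs ≥ 3 → ∀ s t → Σ[ x ∈ A ] (x ∈ xs × x ≢ s × x ≢ t)
  avoid-two (a ∷ b ∷ c ∷ _) ((a≢b ∷ a≢c ∷ _) ∷ (b≢c ∷ _) ∷ _) (s≤s (s≤s (s≤s _))) s t
    with a ≟ s | a ≟ t
  ... | no a≢s | no a≢t = a , here refl , a≢s , a≢t
  ... | yes refl | _ with one-differs b≢c t
  ...   | inj₁ b≢t = b , there (here refl) , a≢b ∘ sym , b≢t
  ...   | inj₂ c≢t = c , there (there (here refl)) , a≢c ∘ sym , c≢t
  avoid-two (a ∷ b ∷ c ∷ _) ((a≢b ∷ a≢c ∷ _) ∷ (b≢c ∷ _) ∷ _) (s≤s (s≤s (s≤s _))) s t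
      | no _ | yes refl with one-differs b≢c s
  ...   | inj₁ b≢s = b , there (here refl) , b≢s , a≢b ∘ sym
  ...   | inj₂ c≢s = c , there (there (here refl)) , c≢s , a≢c ∘ sym

∈-filterᵇ⁻ : ∀ {n} (q : Fin n → Bool) {z} → z ∈ filterᵇ q (allFin n) → T (q z)
∈-filterᵇ⁻ {n} q z∈ = proj₂ (∈-filter⁻ (T? ∘ q) {xs = allFin n} z∈)

third-vertex : ∀ {n} (inK : Fin n → Bool) → count inK false ≥ 3 →
               ∀ i j → ∃[ z ] (inK z ≡ false × z ≢ i × z ≢ j)
third-vertex {n} inK big i j
  with avoid-two _≟F_ _ (filter⁺ (T? ∘ _) (allFin⁺ n)) big i j
... | z , z∈I , z≢i , z≢j with inK z in kz | ∈-filterᵇ⁻ _ z∈I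
...   | false | _ = z , kz , z≢i , z≢j
...   | true | ()

module _ {n : ℕ} (G : Graph n) where

  adj? : ∀ u w → Dec (Adj G u w)
  adj? u w = Graph.adj G u w ≟B true

  adj-sym : ∀ {u w} → Adj G u w → Adj G w u
  adj-sym {u} {w} uw = trans (Graph.sym G w u) uw

  neighbour : ∀ s → ¬ Isolated G s → ∃[ c ] Adj G s c
  neighbour s ¬iso with any? (adj? s)
  ... | yes found = found
  ... | no none = ⊥-elim (¬iso (λ c sc → none (c , sc)))

  Touches : Fin n → Edge G → Set
  Touches k (a , b) = k ≡ a ⊎ k ≡ b

  Covers : List (Edge G) → Fin n → Set
  Covers M k = Any (Touches k) M

  Misses : Fin n → Edge G → Set
  Misses u (a , b) = u ≢ a × u ≢ b

  Avoids : Fin n → List (Edge G) → Set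
  Avoids u M = All (Misses u) M

  disjoint-from-avoiding : ∀ {a b M} → Avoids a M → Avoids b M → All (Disjoint G (a , b)) M
  disjoint-from-avoiding aM bM =
    All.zipWith (λ { ((a≢c , a≢d) , (b≢c , b≢d)) → a≢c , a≢d , b≢c , b≢d }) (aM , bM)

  module Split (inK : Fin n → Bool) (split : IsSplitPartition G inK) where

    K≢I : ∀ {u w} → inK u ≡ true → inK w ≡ false → u ≢ w
    K≢I ku kw refl = case trans (sym ku) kw of λ ()

    I≢K : ∀ {u w} → inK u ≡ false → inK w ≡ true → u ≢ w
    I≢K ku kw = K≢I kw ku ∘ sym

    clique-edge : ∀ {u w} → inK u ≡ true → inK w ≡ true → u ≢ w → Adj G u w
    clique-edge {u} {w} = proj₁ split u w

    I-neighbour-in-K : ∀ {s u} → inK s ≡ false → Adj G s u → inK u ≡ true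
    I-neighbour-in-K {s} {u} ks su with inK u in ku
    ... | true = refl
    ... | false = ⊥-elim (proj₂ split s u ks ku su)

    -- Every edge has an endpoint in K, so a matching covering K is maximal.
    covers-K⇒maximal : ∀ {M} → IsMatching G M → (∀ k → inK k ≡ true → Covers M k) →
                       IsMaximalMatching G M
    covers-K⇒maximal {M} matching cover = matching , blocked
      where
      blocked : ∀ e → IsEdge G e → ¬ (∀ {f} → f ∈ M → Disjoint G e f)
      blocked (p , q) pq disjoint with inK p in kp | inK q in kq
      ... | true | _ with find (cover p kp)
      ...   | f , f∈M , inj₁ p≡ = proj₁ (disjoint f∈M) p≡
      ...   | f , f∈M , inj₂ p≡ = proj₁ (proj₂ (disjoint f∈M)) p≡
      blocked (p , q) pq disjoint | false | true with find (cover q kq)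
      ...   | f , f∈M , inj₁ q≡ = proj₁ (proj₂ (proj₂ (disjoint f∈M))) q≡
      ...   | f , f∈M , inj₂ q≡ = proj₂ (proj₂ (proj₂ (disjoint f∈M))) q≡
      blocked (p , q) pq disjoint | false | false = proj₂ split p q kp kq pq

    -- Greedy pairing of a list of clique vertices; the clique vertex d, matched
    -- to its I-neighbour z, absorbs a possible leftover vertex.
    module Pairing {d z : Fin n} (kd : inK d ≡ true) (kz : inK z ≡ false) (dz : Adj G d z) where

      pairOff : List (Fin n) → List (Edge G)
      pairOff []           = (d , z) ∷ []
      pairOff (p ∷ [])     = (p , d) ∷ []
      pairOff (p ∷ q ∷ ps) = (p , q) ∷ pairOff ps

      pairOff-avoids : ∀ ps {u} → u ∉ ps → u ≢ d → u ≢ z → Avoids u (pairOff ps)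
      pairOff-avoids []           u∉ u≢d u≢z = (u≢d , u≢z) ∷ []
      pairOff-avoids (p ∷ [])     u∉ u≢d u≢z = (u∉ ∘ here , u≢d) ∷ []
      pairOff-avoids (p ∷ q ∷ ps) u∉ u≢d u≢z =
        (u∉ ∘ here , u∉ ∘ there ∘ here) ∷ pairOff-avoids ps (u∉ ∘ there ∘ there) u≢d u≢z

      pairOff-covers : ∀ ps {k} → k ∈ d ∷ ps → Covers (pairOff ps) k
      pairOff-covers []           (here refl)                 = here (inj₁ refl)
      pairOff-covers (p ∷ [])     (here refl)                 = here (inj₂ refl)
      pairOff-covers (p ∷ [])     (there (here refl))         = here (inj₁ refl)
      pairOff-covers (p ∷ q ∷ ps) (here refl)                 = there (pairOff-covers ps (here refl))
      pairOff-covers (p ∷ q ∷ ps) (there (here refl))         = here (inj₁ refl)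
      pairOff-covers (p ∷ q ∷ ps) (there (there (here refl))) = here (inj₂ refl)
      pairOff-covers (p ∷ q ∷ ps) (there (there (there k∈))) = there (pairOff-covers ps (there k∈))

      pairOff-edges : ∀ ps → Unique ps → d ∉ ps → All (λ p → inK p ≡ true) ps →
                      ∀ {f} → f ∈ pairOff ps → IsEdge G f
      pairOff-edges []           _ _ _ (here refl) = dz
      pairOff-edges (p ∷ [])     _ d∉ (kp ∷ _) (here refl) = clique-edge kp kd (d∉ ∘ here ∘ sym)
      pairOff-edges (p ∷ q ∷ ps) ((p≢q ∷ _) ∷ _) _ (kp ∷ kq ∷ _) (here refl) = clique-edge kp kq p≢q
      pairOff-edges (p ∷ q ∷ ps) (_ ∷ _ ∷ unique) d∉ (_ ∷ _ ∷ inK-ps) (there f∈) =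
        pairOff-edges ps unique (d∉ ∘ there ∘ there) inK-ps f∈

      pairOff-disjoint : ∀ ps → Unique ps → d ∉ ps → All (λ p → inK p ≡ true) ps →
                         AllPairs (Disjoint G) (pairOff ps)
      pairOff-disjoint []       _ _ _ = [] ∷ []
      pairOff-disjoint (p ∷ []) _ _ _ = [] ∷ []
      pairOff-disjoint (p ∷ q ∷ ps) ((_ ∷ p∉ps) ∷ q∉ps ∷ unique) d∉ (kp ∷ kq ∷ inK-ps) =
        disjoint-from-avoiding
          (pairOff-avoids ps (All¬⇒¬Any p∉ps) (d∉ ∘ here ∘ sym) (K≢I kp kz))
          (pairOff-avoids ps (All¬⇒¬Any q∉ps) (d∉ ∘ there ∘ here ∘ sym) (K≢I kq kz))
        ∷ pairOff-disjoint ps unique (d∉ ∘ there ∘ there) inK-ps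

      pairOff-matching : ∀ ps → Unique ps → d ∉ ps → All (λ p → inK p ≡ true) ps →
                         IsMatching G (pairOff ps)
      pairOff-matching ps unique d∉ inK-ps =
        pairOff-edges ps unique d∉ inK-ps , pairOff-disjoint ps unique d∉ inK-ps

    module Equimatchable-Split (equi : Equimatchable G) where

      -- Exchange: for disjoint K–I edges ax, by and a matching Q covering
      -- K ∖ {a, b} away from a, b, x, y, the maximal matchings
      -- {ax, by} ∪ Q and {ab} ∪ Q have different sizes.
      exchange : ∀ {a b x y} → inK a ≡ true → inK b ≡ true → inK x ≡ false → inK y ≡ false →
        a ≢ b → x ≢ y → Adj G a x → Adj G b y →
        ∀ {Q} → IsMatching G Q → Avoids a Q → Avoids b Q → Avoids x Q → Avoids y Q →
        (∀ k → inK k ≡ true → k ≢ a → k ≢ b → Covers Q k) → ⊥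
      exchange {a} {b} {x} {y} ka kb kx ky a≢b x≢y ax by {Q} (edgesQ , disjointQ) aQ bQ xQ yQ coverQ =
        1+n≢n (equi M₁ M₂ (covers-K⇒maximal matching₁ cover₁) (covers-K⇒maximal matching₂ cover₂))
        where
        M₁ M₂ : List (Edge G)
        M₁ = (a , x) ∷ (b , y) ∷ Q
        M₂ = (a , b) ∷ Q
        matching₁ : IsMatching G M₁
        matching₁ =
          (λ { (here refl) → ax ; (there (here refl)) → by ; (there (there f∈)) → edgesQ f∈ })
          , ((a≢b , K≢I ka ky , I≢K kx kb , x≢y) ∷ disjoint-from-avoiding aQ xQ)
          ∷ disjoint-from-avoiding bQ yQ ∷ disjointQ
        matching₂ : IsMatching G M₂
        matching₂ =
          (λ { (here refl) → clique-edge ka kb a≢b ; (there f∈) → edgesQ f∈ })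
          , disjoint-from-avoiding aQ bQ ∷ disjointQ
        cover₁ : ∀ k → inK k ≡ true → Covers M₁ k
        cover₁ k kk with k ≟F a | k ≟F b
        ... | yes refl | _ = here (inj₁ refl)
        ... | no _ | yes refl = there (here (inj₁ refl))
        ... | no k≢a | no k≢b = there (there (coverQ k kk k≢a k≢b))
        cover₂ : ∀ k → inK k ≡ true → Covers M₂ k
        cover₂ k kk with k ≟F a | k ≟F b
        ... | yes refl | _ = here (inj₁ refl)
        ... | no _ | yes refl = here (inj₂ refl)
        ... | no k≢a | no k≢b = there (coverQ k kk k≢a k≢b)

      no-three-disjoint : ∀ {a b d x y z} →
        inK a ≡ true → inK b ≡ true → inK d ≡ true →
        inK x ≡ false → inK y ≡ false → inK z ≡ false →
        a ≢ b → a ≢ d → b ≢ d → x ≢ y → x ≢ z → y ≢ z →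
        Adj G a x → Adj G b y → Adj G d z → ⊥
      no-three-disjoint {a} {b} {d} {x} {y} {z} ka kb kd kx ky kz a≢b a≢d b≢d x≢y x≢z y≢z ax by dz =
        exchange ka kb kx ky a≢b x≢y ax by
          (pairOff-matching rest (filter⁺ rest? (allFin⁺ n)) (outside-rest (λ r → proj₂ (proj₂ (proj₂ r)) refl))
            (All.tabulate (proj₁ ∘ in-rest)))
          (avoids (outside-rest (λ r → proj₁ (proj₂ r) refl)) a≢d (K≢I ka kz))
          (avoids (outside-rest (λ r → proj₁ (proj₂ (proj₂ r)) refl)) b≢d (K≢I kb kz))
          (avoids (outside-rest (λ r → I≢K kx (proj₁ r) refl)) (I≢K kx kd) x≢z)
          (avoids (outside-rest (λ r → I≢K ky (proj₁ r) refl)) (I≢K ky kd) y≢z)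
          cover
        where
        open Pairing kd kz dz
        Rest : Fin n → Set
        Rest k = inK k ≡ true × k ≢ a × k ≢ b × k ≢ d
        rest? : ∀ k → Dec (Rest k)
        rest? k = (inK k ≟B true) ×-dec ¬? (k ≟F a) ×-dec ¬? (k ≟F b) ×-dec ¬? (k ≟F d)
        rest : List (Fin n)
        rest = filter rest? (allFin n)
        in-rest : ∀ {k} → k ∈ rest → Rest k
        in-rest = proj₂ ∘ ∈-filter⁻ rest? {xs = allFin n}
        outside-rest : ∀ {u} → ¬ Rest u → u ∉ rest
        outside-rest ¬rest = ¬rest ∘ in-rest
        avoids : ∀ {u} → u ∉ rest → u ≢ d → u ≢ z → Avoids u (pairOff rest)
        avoids = pairOff-avoids rest
        cover : ∀ k → inK k ≡ true → k ≢ a → k ≢ b → Covers (pairOff rest) k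
        cover k kk k≢a k≢b with k ≟F d
        ... | yes refl = pairOff-covers rest (here refl)
        ... | no k≢d = pairOff-covers rest (there (∈-filter⁺ rest? (∈-allFin k) (kk , k≢a , k≢b , k≢d)))

      confined : ∀ {a b r x y s} → inK a ≡ true → inK b ≡ true → inK r ≡ true →
        inK x ≡ false → inK y ≡ false → inK s ≡ false →
        a ≢ b → r ≢ a → r ≢ b → x ≢ y → Adj G a x → Adj G b y → Adj G r s →
        s ≡ x ⊎ s ≡ y
      confined {x = x} {y = y} {s = s} ka kb kr kx ky ks a≢b r≢a r≢b x≢y ax by rs with s ≟F x | s ≟F y
      ... | yes s≡x | _ = inj₁ s≡x
      ... | no _ | yes s≡y = inj₂ s≡y
      ... | no s≢x | no s≢y =
        ⊥-elim (no-three-disjoint ka kb kr kx ky ks a≢b (r≢a ∘ sym) (r≢b ∘ sym) x≢y (s≢x ∘ sym) (s≢y ∘ sym) ax by rs)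

      module Neighbourhoods
        (no-isolated : NoIsolated G)
        (K-sees-I : ∀ u → inK u ≡ true → ∃[ y ] (inK y ≡ false × Adj G u y))
        {v i j : Fin n} (kv : inK v ≡ true) (ki : inK i ≡ false) (kj : inK j ≡ false)
        (¬vi : ¬ Adj G v i) (vj : Adj G v j) where

        i≢j : i ≢ j
        i≢j refl = ¬vi vj

        -- Every clique vertex outside N(i) is adjacent to j: otherwise, with c
        -- a neighbour of i, the edges ci, vj confine u's I-neighbours to {i, j}.
        adjacent-outside-N[i] : ∀ {u} → inK u ≡ true → ¬ Adj G i u → Adj G j u
        adjacent-outside-N[i] {u} ku ¬iu = decidable-stable (adj? j u) missed-by-both
          where
          missed-by-both : ¬ ¬ Adj G j u
          missed-by-both ¬ju with neighbour i (no-isolated i) | K-sees-I u ku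
          ... | c , ic | y , ky , uy =
            case confined (I-neighbour-in-K ki ic) kv ku ki kj ky c≢v u≢c u≢v i≢j (adj-sym ic) vj uy of λ
              { (inj₁ refl) → ¬iu (adj-sym uy) ; (inj₂ refl) → ¬ju (adj-sym uy) }
            where
            c≢v : c ≢ v
            c≢v refl = ¬vi (adj-sym ic)
            u≢c : u ≢ c
            u≢c refl = ¬iu ic
            u≢v : u ≢ v
            u≢v refl = ¬ju (adj-sym vj)

        -- If some clique vertex w misses j and |I| ≥ 3, then i and j have no
        -- common neighbour u: confinement forces wi ∈ E, and then a third
        -- vertex z ∈ I has no admissible neighbour c.
        no-common-neighbour : ∀ {w} → inK w ≡ true → ¬ Adj G j w → count inK false ≥ 3 →
                              ∀ {u} → Adj G j u → ¬ Adj G i u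
        no-common-neighbour {w} kw ¬jw big {u} ju iu with third-vertex inK big i j
        ... | z , kz , z≢i , z≢j with neighbour z (no-isolated z)
        ... | c , zc = z-outside (neighbour-confined (I-neighbour-in-K kz zc) (adj-sym zc))
          where
          ku : inK u ≡ true
          ku = I-neighbour-in-K kj ju
          ui : Adj G u i
          ui = adj-sym iu
          u≢v : u ≢ v
          u≢v refl = ¬vi ui
          u≢w : u ≢ w
          u≢w refl = ¬jw ju
          w≢v : w ≢ v
          w≢v refl = ¬jw (adj-sym vj)
          -- an I-neighbour of w is confined to {i, j} by ui, vj, and is not j
          wi : Adj G w i
          wi with K-sees-I w kw
          ... | y , ky , wy with confined ku kv kw ki kj ky u≢v (u≢w ∘ sym) w≢v i≢j ui vj wy
          ...   | inj₁ refl = wy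
          ...   | inj₂ refl = ⊥-elim (¬jw (adj-sym wy))
          -- the neighbour c of z is confined by ui, vj (c = w), by wi, uj
          -- (c = v), or by wi, vj (otherwise)
          neighbour-confined : inK c ≡ true → Adj G c z → z ≡ i ⊎ z ≡ j
          neighbour-confined kc cz with c ≟F w | c ≟F v
          ... | yes refl | _ = confined ku kv kw ki kj kz u≢v (u≢w ∘ sym) w≢v i≢j ui vj cz
          ... | no _ | yes refl =
            confined kw ku kv ki kj kz (u≢w ∘ sym) (w≢v ∘ sym) (u≢v ∘ sym) i≢j wi (adj-sym ju) cz
          ... | no c≢w | no c≢v = confined kw kv kc ki kj kz w≢v c≢w c≢v i≢j wi vj cz
          z-outside : z ≡ i ⊎ z ≡ j → ⊥
          z-outside (inj₁ z≡i) = z≢i z≡i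
          z-outside (inj₂ z≡j) = z≢j z≡j

lemma2p5 : {n : ℕ} (G : Graph n) (inK : Fin n → Bool) →
    NoIsolated G →
    IsSplitPartition G inK →
    (∀ v → inK v ≡ true → ∃[ u ] (inK u ≡ false × Adj G v u)) →
    Equimatchable G →
    count inK false ≥ 3 →
    count inK true ≥ 2 →
    (v i : Fin n) → inK v ≡ true → inK i ≡ false → ¬ Adj G v i →
    (j : Fin n) → inK j ≡ false → Adj G v j →
    (∀ u → Adj G j u ⇔ (inK u ≡ true × ¬ Adj G i u))
    ⊎ (∀ u → Adj G j u ⇔ inK u ≡ true)
lemma2p5 G inK no-isolated split K-sees-I equi big _ v i kv ki ¬vi j kj vj
  with any? (λ w → (inK w ≟B true) ×-dec ¬? (adj? G j w))
... | no j-sees-K =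
  inj₂ λ u → mk⇔ (I-neighbour-in-K kj)
                 (λ ku → decidable-stable (adj? G j u) (λ ¬ju → j-sees-K (u , ku , ¬ju)))
  where open Split G inK split
... | yes (w , kw , ¬jw) =
  inj₁ λ u → mk⇔ (λ ju → I-neighbour-in-K kj ju , no-common-neighbour kw ¬jw big ju)
                 (uncurry adjacent-outside-N[i])
  where
  open Split G inK split
  open Equimatchable-Split equi
  open Neighbourhoods no-isolated K-sees-I kv ki kj ¬vi vj
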